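{- Let $k$ be a field, $W$ the weight of a Riemann function $\mathbb{Z}^2\to\mathbb{Z}$, $\mathbf{d},\mathbf{K}\in\mathbb{Z}^2$ and $\mathbf{L}=\mathbf{K}+(1,1)$. Write $W=(W_1+\cdots+W_s)-(\tilde W_1+\cdots+\tilde W_{s-1})$ with perfect matchings $W_r,\tilde W_r$, so that $W^*_{\mathbf{L}}=\sum_r(W_r)^*_{\mathbf{L}}-\sum_r(\tilde W_r)^*_{\mathbf{L}}$. Then for $i=0,1$ there is an isomorphism of virtual $k$-vector spaces $$H^i([\mathcal{M}_{W,\mathbf{d}}])^*\to H^{1-i}([\mathcal{M}_{W^*_{\mathbf{L}},\mathbf{K}-\mathbf{d}}]),$$ where $H^i([\mathcal{M}_{W,\mathbf{d}}])$ is represented by $\big(\bigoplus_r H^i(\mathcal{M}_{W_r,\mathbf{d}}),\bigoplus_r H^i(\mathcal{M}_{\tilde W_r,\mathbf{d}})\big)$ and $H^{1-i}([\mathcal{M}_{W^*_{\mathbf{L}},\mathbf{K}-\mathbf{d}}])$ by $\big(\bigoplus_r H^{1-i}(\mathcal{M}_{(W_r)^*_{\mathbf{L}},\mathbf{K}-\mathbf{d}}),\bigoplus_r H^{1-i}(\mathcal{M}_{(\tilde W_r)^*_{\mathbf{L}},\mathbf{K}-\mathbf{d}})\big)$.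
   Context: A Riemann function is $f\colon\mathbb{Z}^2\to\mathbb{Z}$ such that for some $C$, $f(\mathbf{d})=0$ for $d_1+d_2$ sufficiently small and $f(\mathbf{d})=d_1+d_2+C$ for $d_1+d_2$ sufficiently large. Its weight is the unique $W$, zero for $d_1+d_2$ small, with $f(\mathbf{d})=\sum_{\mathbf{d}'\le\mathbf{d}}W(\mathbf{d}')$ (componentwise order); such a $W$ can always be written as a difference of sums of perfect matchings as in the claim. A perfect matching is $W\colon\mathbb{Z}^2\to\mathbb{Z}$, zero for $d_1+d_2$ sufficiently small or large, with a bijection $\pi$ of $\mathbb{Z}$ such that $W(a,b)=1$ if $b=\pi(a)$ and $0$ otherwise. $W^*_{\mathbf{L}}(\mathbf{d})=W(\mathbf{L}-\mathbf{d})$. A $k$-diagram: $k$-vector spaces $\mathcal{F}(B_1),\mathcal{F}(B_2),\mathcal{F}(B_3),\mathcal{F}(A_1),\mathcal{F}(A_2)$ with maps $\rho_{1,1}\colon\mathcal{F}(B_1)\to\mathcal{F}(A_1)$, $\rho_{2,2}\colon\mathcal{F}(B_2)\to\mathcal{F}(A_2)$, $\rho_{3,1},\rho_{3,2}$ from $\mathcal{F}(B_3)$ to $\mathcal{F}(A_1),\mathcal{F}(A_2)$; differential $\partial(b_1,b_2,b_3)=(\rho_{1,1}b_1-\rho_{3,1}b_3,\rho_{2,2}b_2-\rho_{3,2}b_3)$; $H^0=\ker\partial$, $H^1=\operatorname{coker}\partial$. For a perfect matching $W$ with bijection $\pi$, $\mathcal{M}_{W,\mathbf{d}}$ has $B_i$-value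 $k^{\oplus\mathbb{Z}_{\le d_i}}$, $A_i$-value $k^{\oplus\mathbb{Z}}$ ($k^{\oplus S}$ has basis $\{\mathbf{e}_s\}$), $\rho_{i,i}$ inclusions, $B_3$-value with basis indexed by $\{(a,\pi(a))\}$, $\rho_{3,1},\rho_{3,2}$ sending it to $\mathbf{e}_a,\mathbf{e}_{\pi(a)}$; its cohomology is finite dimensional. $[\mathcal{M}_{W,\mathbf{d}}]$ is the class of the virtual $k$-diagram $(\bigoplus_r\mathcal{M}_{W_r,\mathbf{d}},\bigoplus_r\mathcal{M}_{\tilde W_r,\mathbf{d}})$. A virtual $k$-vector space is a pair $(V_1,V_2)$ of finite-dimensional $k$-vector spaces; its dual is $(V_1,V_2)^*=(V_1^*,V_2^*)$; an isomorphism $(V_1,V_2)\to(V_3,V_4)$ means a pair of linear isomorphisms $V_1\to V_3$, $V_2\to V_4$. -}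

module Defs where

open import Level using (0ℓ)
open import Algebra.Bundles using (CommutativeRing)
open import Data.Bool using (if_then_else_)
open import Data.Empty using (⊥)
open import Data.Unit using (⊤; tt)
open import Data.Nat using (ℕ; zero; suc)
open import Data.Fin using (Fin; zero; suc)
open import Data.Integer as ℤ using (ℤ; +_; _-_; _<_; _≤_; _≤?_)
import Data.Integer.Properties as ℤP
open import Data.Integer.Tactic.RingSolver using (solve-∀)
open import Data.List using (List; []; _∷_; _++_; map; foldr; applyUpTo)
open import Data.Product using (Σ; ∃; _×_; _,_; proj₁; proj₂)
open import Data.Product.Properties using (≡-dec)
open import Function.Definitions using (Bijective)
open import Relation.Nullary using (¬_; does; yes; no)
open import Relation.Binary.Definitions using (DecidableEquality)
open import Relation.Binary.PropositionalEquality
  using (_≡_; _≢_; refl; sym; trans; cong; subst)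

record Field : Set₁ where
  field
    commutativeRing : CommutativeRing 0ℓ 0ℓ
  open CommutativeRing commutativeRing public
  field
    0≉1     : ¬ (0# ≈ 1#)
    inverse : ∀ x → ¬ (x ≈ 0#) → ∃ λ y → (x * y) ≈ 1#

range : ℤ → ℤ → List ℤ
range lo hi =
  if does (lo ≤? hi)
  then applyUpTo (λ n → lo ℤ.+ (+ n)) (suc ℤ.∣ hi - lo ∣)
  else []

sumℤ : List ℤ → ℤ
sumℤ = foldr ℤ._+_ (+ 0)

sumFin : ∀ {n} → (Fin n → ℤ) → ℤ
sumFin {zero}  f = + 0
sumFin {suc n} f = f zero ℤ.+ sumFin (λ r → f (suc r))

IsRiemannFunction : (ℤ → ℤ → ℤ) → Set
IsRiemannFunction f =
  Σ ℤ λ C → Σ ℤ λ m → Σ ℤ λ M →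
    (∀ d₁ d₂ → d₁ ℤ.+ d₂ ≤ m → f d₁ d₂ ≡ + 0) ×
    (∀ d₁ d₂ → M ≤ d₁ ℤ.+ d₂ → f d₁ d₂ ≡ (d₁ ℤ.+ d₂) ℤ.+ C)

-- Since W vanishes off {d'₁+d'₂ ≥ m}, the
-- (a priori infinite) sum over d' ≤ d is the finite sum over the box
-- m - d₂ ≤ d'₁ ≤ d₁, m - d₁ ≤ d'₂ ≤ d₂ (which contains every d' ≤ d with
-- d'₁+d'₂ ≥ m and is contained in {d' ≤ d}).
IsWeightOf : (ℤ → ℤ → ℤ) → (ℤ → ℤ → ℤ) → Set
IsWeightOf f W =
  Σ ℤ λ m →
    (∀ a b → a ℤ.+ b < m → W a b ≡ + 0) ×
    (∀ d₁ d₂ → f d₁ d₂ ≡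
       sumℤ (map (λ a → sumℤ (map (λ b → W a b) (range (m - d₁) d₂)))
                 (range (m - d₂) d₁)))

record IsPerfectMatching (W : ℤ → ℤ → ℤ) : Set where
  field
    π         : ℤ → ℤ
    π-bij     : Bijective _≡_ _≡_ π
    on-graph  : ∀ a → W a (π a) ≡ + 1
    off-graph : ∀ a b → b ≢ π a → W a b ≡ + 0
    lo        : ℤ
    below     : ∀ a b → a ℤ.+ b < lo → W a b ≡ + 0
    hi        : ℤ
    above     : ∀ a b → hi < a ℤ.+ b → W a b ≡ + 0

dualW : ℤ × ℤ → (ℤ → ℤ → ℤ) → (ℤ → ℤ → ℤ)
dualW (L₁ , L₂) W a b = W (L₁ - a) (L₂ - b)

private
  lemA : ∀ i x → i - (i - x) ≡ x
  lemA = solve-∀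

  lemB : ∀ S h x → (x ℤ.+ (h - x)) ≡ h
  lemB = solve-∀

  lemC : ∀ L₁ L₂ a b h → (L₁ ℤ.+ L₂) - h ℤ.+ (h - (a ℤ.+ b)) ≡ (L₁ - a) ℤ.+ (L₂ - b)
  lemC = solve-∀

dualPM : (L : ℤ × ℤ) {W : ℤ → ℤ → ℤ} →
         IsPerfectMatching W → IsPerfectMatching (dualW L W)
dualPM (L₁ , L₂) {W} pm = record
  { π         = π*
  ; π-bij     = inj , surj
  ; on-graph  = λ a → subst (λ z → W (L₁ - a) z ≡ + 1)
                           (sym (lemA L₂ (π (L₁ - a)))) (on-graph (L₁ - a))
  ; off-graph = λ a b b≢ → off-graph (L₁ - a) (L₂ - b)
                  (λ e → b≢ (trans (sym (lemA L₂ b)) (cong (L₂ -_) e)))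
  ; lo        = (L₁ ℤ.+ L₂) - hi
  ; below     = λ a b lt → above (L₁ - a) (L₂ - b)
                  (subst₂< (lemB (+ 0) hi (a ℤ.+ b)) (lemC L₁ L₂ a b hi)
                     (ℤP.+-monoˡ-< (hi - (a ℤ.+ b)) lt))
  ; hi        = (L₁ ℤ.+ L₂) - lo
  ; above     = λ a b lt → below (L₁ - a) (L₂ - b)
                  (subst₂< (lemC L₁ L₂ a b lo) (lemB (+ 0) lo (a ℤ.+ b))
                     (ℤP.+-monoˡ-< (lo - (a ℤ.+ b)) lt))
  }
  where
  open IsPerfectMatching pm
  π* : ℤ → ℤ
  π* a = L₂ - π (L₁ - a)
  subst₂< : ∀ {x x' y y'} → x ≡ x' → y ≡ y' → x < y → x' < y'
  subst₂< refl refl p = p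
  inj : ∀ {x y} → π* x ≡ π* y → x ≡ y
  inj {x} {y} e =
    let e1 = trans (sym (lemA L₂ (π (L₁ - x))))
                   (trans (cong (L₂ -_) e) (lemA L₂ (π (L₁ - y))))
        e2 = proj₁ π-bij e1
    in trans (sym (lemA L₁ x)) (trans (cong (L₁ -_) e2) (lemA L₁ y))
  surj : ∀ y → ∃ λ x → ∀ {z} → z ≡ x → π* z ≡ y
  surj y with proj₂ π-bij (L₂ - y)
  ... | (x , h) = L₁ - x , λ {z} e →
        trans (cong (L₂ -_) (h (trans (cong (L₁ -_) e) (lemA L₁ x))))
              (lemA L₂ y)

-- A "space" is given by an ambient carrier with the vector operations,
-- a predicate In cutting out the elements of the space (used for kernels
-- and for duals), and the equality _≈_ of the space (used for quotients).
-- The vector space axioms are not recorded: every space occurring in the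
-- theorem is built concretely below, and all statements only use the
-- operations.

module LinearAlgebra (K : Field) where

  private
    module K = Field K
  Scalar : Set
  Scalar = K.Carrier

  record Space : Set₁ where
    field
      Carrier : Set
      In      : Carrier → Set
      _≈_     : Carrier → Carrier → Set
      _+_     : Carrier → Carrier → Carrier
      0v      : Carrier
      -_      : Carrier → Carrier
      _·_     : Scalar → Carrier → Carrier
    _-ᵥ_ : Carrier → Carrier → Carrier
    x -ᵥ y = x + (- y)

  open Space

  record LinearIso (V W : Space) : Set where
    private
      module V = Space V
      module W = Space W
    field
      f        : (x : V.Carrier) → V.In x → W.Carrier
      f-in     : ∀ x p → W.In (f x p)
      f-cong   : ∀ x y p q → x V.≈ y → f x p W.≈ f y q
      f-+      : ∀ x y p q r → f (x V.+ y) r W.≈ (f x p W.+ f y q)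
      f-·      : ∀ c x p r → f (c V.· x) r W.≈ (c W.· f x p)
      injective  : ∀ x y p q → f x p W.≈ f y q → x V.≈ y
      surjective : ∀ w → W.In w → Σ V.Carrier λ x → Σ (V.In x) λ p → f x p W.≈ w

  IsLinearFunctional : (V : Space) → ((x : Carrier V) → In V x → Scalar) → Set
  IsLinearFunctional V φ =
    (∀ x y p q → _≈_ V x y → φ x p K.≈ φ y q) ×
    (∀ x y p q r → φ (_+_ V x y) r K.≈ (φ x p K.+ φ y q)) ×
    (∀ c x p r → φ (_·_ V c x) r K.≈ (c K.* φ x p))

  Dual : Space → Space
  Dual V = record
    { Carrier = (x : Carrier V) → In V x → Scalar
    ; In      = IsLinearFunctional V
    ; _≈_     = λ φ ψ → ∀ x p → φ x p K.≈ ψ x p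
    ; _+_     = λ φ ψ x p → φ x p K.+ ψ x p
    ; 0v      = λ _ _ → K.0#
    ; -_      = λ φ x p → K.- φ x p
    ; _·_     = λ c φ x p → c K.* φ x p
    }

  _⊕_ : Space → Space → Space
  V ⊕ W = record
    { Carrier = Carrier V × Carrier W
    ; In      = λ x → In V (proj₁ x) × In W (proj₂ x)
    ; _≈_     = λ x y → _≈_ V (proj₁ x) (proj₁ y) × _≈_ W (proj₂ x) (proj₂ y)
    ; _+_     = λ x y → _+_ V (proj₁ x) (proj₁ y) , _+_ W (proj₂ x) (proj₂ y)
    ; 0v      = 0v V , 0v W
    ; -_      = λ x → (-_) V (proj₁ x) , (-_) W (proj₂ x)
    ; _·_     = λ c x → _·_ V c (proj₁ x) , _·_ W c (proj₂ x)
    }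

  ⨁ : ∀ {n} → (Fin n → Space) → Space
  ⨁ {n} V = record
    { Carrier = (r : Fin n) → Carrier (V r)
    ; In      = λ x → ∀ r → In (V r) (x r)
    ; _≈_     = λ x y → ∀ r → _≈_ (V r) (x r) (y r)
    ; _+_     = λ x y r → _+_ (V r) (x r) (y r)
    ; 0v      = λ r → 0v (V r)
    ; -_      = λ x r → (-_) (V r) (x r)
    ; _·_     = λ c x r → _·_ (V r) c (x r)
    }

  -- k^{⊕S} for S = {i ∈ I ∣ P i}: finite formal linear combinations of
  -- basis vectors e_s (s ∈ S), two combinations being equal iff they
  -- have the same coefficient at every index.
  module FreeSpace {I : Set} (_≟_ : DecidableEquality I) (P : I → Set) where
    Index : Set
    Index = Σ I P

    coeff : List (Index × Scalar) → I → Scalar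
    coeff []             i = K.0#
    coeff ((s , c) ∷ xs) i with proj₁ s ≟ i
    ... | yes _ = c K.+ coeff xs i
    ... | no  _ = coeff xs i

    space : Space
    space = record
      { Carrier = List (Index × Scalar)
      ; In      = λ _ → ⊤
      ; _≈_     = λ u v → ∀ i → coeff u i K.≈ coeff v i
      ; _+_     = _++_
      ; 0v      = []
      ; -_      = map (λ t → proj₁ t , K.- proj₂ t)
      ; _·_     = λ c → map (λ t → proj₁ t , c K.* proj₂ t)
      }

  induced : {I J : Set} {P : I → Set} {Q : J → Set} →
            (Σ I P → Σ J Q) → List (Σ I P × Scalar) → List (Σ J Q × Scalar)
  induced φ = map (λ t → φ (proj₁ t) , proj₂ t)

  record Diagram : Set₁ where
    field
      B₁ B₂ B₃ A₁ A₂ : Space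
      ρ₁₁ : Carrier B₁ → Carrier A₁
      ρ₂₂ : Carrier B₂ → Carrier A₂
      ρ₃₁ : Carrier B₃ → Carrier A₁
      ρ₃₂ : Carrier B₃ → Carrier A₂

    B : Space
    B = B₁ ⊕ (B₂ ⊕ B₃)

    A : Space
    A = A₁ ⊕ A₂

    ∂ : Carrier B → Carrier A
    ∂ (b₁ , b₂ , b₃) = _-ᵥ_ A₁ (ρ₁₁ b₁) (ρ₃₁ b₃) , _-ᵥ_ A₂ (ρ₂₂ b₂) (ρ₃₂ b₃)

    H⁰ : Space
    H⁰ = record
      { Carrier = Carrier B
      ; In      = λ b → In B b × _≈_ A (∂ b) (0v A)
      ; _≈_     = _≈_ B
      ; _+_     = _+_ B
      ; 0v      = 0v B
      ; -_      = -_ B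
      ; _·_     = _·_ B
      }

    H¹ : Space
    H¹ = record
      { Carrier = Carrier A
      ; In      = In A
      ; _≈_     = λ x y → Σ (Carrier B) λ b → In B b × _≈_ A (∂ b) (_-ᵥ_ A x y)
      ; _+_     = _+_ A
      ; 0v      = 0v A
      ; -_      = -_ A
      ; _·_     = _·_ A
      }

  H : Fin 2 → Diagram → Space
  H zero          D = Diagram.H⁰ D
  H (suc zero)    D = Diagram.H¹ D

  compl : Fin 2 → Fin 2
  compl zero       = suc zero
  compl (suc zero) = zero

  M : (W : ℤ → ℤ → ℤ) → IsPerfectMatching W → ℤ × ℤ → Diagram
  M W pm (d₁ , d₂) = record
    { B₁  = FreeSpace.space ℤ._≟_ (λ s → s ≤ d₁)
    ; B₂  = FreeSpace.space ℤ._≟_ (λ s → s ≤ d₂)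
    ; B₃  = FreeSpace.space (≡-dec ℤ._≟_ ℤ._≟_)
                            (λ p → proj₂ p ≡ IsPerfectMatching.π pm (proj₁ p))
    ; A₁  = FreeSpace.space ℤ._≟_ (λ _ → ⊤)
    ; A₂  = FreeSpace.space ℤ._≟_ (λ _ → ⊤)
    ; ρ₁₁ = induced (λ s → proj₁ s , tt)
    ; ρ₂₂ = induced (λ s → proj₁ s , tt)
    ; ρ₃₁ = induced (λ p → proj₁ (proj₁ p) , tt)
    ; ρ₃₂ = induced (λ p → proj₂ (proj₁ p) , tt)
    }

  record Virtual : Set₁ where
    constructor ⟨_,_⟩
    field
      V₁ V₂ : Space

  DualV : Virtual → Virtual
  DualV ⟨ V₁ , V₂ ⟩ = ⟨ Dual V₁ , Dual V₂ ⟩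

  VirtualIso : Virtual → Virtual → Set
  VirtualIso ⟨ V₁ , V₂ ⟩ ⟨ V₃ , V₄ ⟩ = LinearIso V₁ V₃ × LinearIso V₂ V₄

  HVirt : Fin 2 → ∀ {s t} →
          (Ws : Fin s → ℤ → ℤ → ℤ) → (∀ r → IsPerfectMatching (Ws r)) →
          (Wt : Fin t → ℤ → ℤ → ℤ) → (∀ r → IsPerfectMatching (Wt r)) →
          ℤ × ℤ → Virtual
  HVirt i Ws pms Wt pmt d =
    ⟨ ⨁ (λ r → H i (M (Ws r) (pms r) d)) , ⨁ (λ r → H i (M (Wt r) (pmt r) d)) ⟩

{-# OPTIONS --safe #-}
-- Both sides are direct sums over the perfect matchings, so fix one, with
-- bijection π. A cycle of M_{W,d} is determined by its coefficients at the
-- graph points (a, π a) with a ≤ d₁ and π a ≤ d₂, so H⁰ has a basis indexed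
-- by these finitely many a. Dually, u ↦ u₁(a) - u₂(π a) vanishes on
-- boundaries when a > d₁ and π a > d₂, and every u on which all these
-- functionals vanish is a boundary, so H¹ has a basis indexed by such a.
-- The reflection a ↦ L₁ - a maps the graph of π onto that of the dual
-- matching and, because L = K + (1,1), exchanges the two index sets of
-- (W, d) and (W*_L, K - d). Spaces with bases indexed by the same finite
-- set are dual to each other, compatibly with direct sums.
module Submission where

open import Defs
open import Algebra.Bundles using (AbelianGroup)
import Algebra.Properties.AbelianGroup as AbelianGroupProperties
import Algebra.Properties.CommutativeSemigroup as CommutativeSemigroupProperties
import Algebra.Properties.Group as GroupProperties
import Algebra.Properties.Ring as RingProperties
open import Data.Bool using (true; false; if_then_else_)
open import Data.Empty using (⊥-elim)
open import Data.Fin as Fin using (Fin; zero; suc)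
open import Data.Integer as ℤ using (ℤ; +_; ∣_∣; _≤_; _<_; _≤?_)
import Data.Integer.Properties as ℤP
open import Data.Integer.Tactic.RingSolver using (solve-∀)
open import Data.List using (List; []; _∷_; _++_; map; applyUpTo; filter)
open import Data.List.Membership.Propositional using (_∈_)
open import Data.List.Membership.Propositional.Properties
  using (∈-applyUpTo⁺; ∈-filter⁺; ∈-filter⁻; ∈-map⁺; ∈-map⁻; ∈-++⁺ˡ; ∈-++⁺ʳ; ∈-++⁻)
open import Data.List.Relation.Unary.All using (lookup)
open import Data.List.Relation.Unary.AllPairs using ([]; _∷_)
open import Data.List.Relation.Unary.Any using (here; there)
open import Data.List.Relation.Unary.Unique.Propositional using (Unique)
import Data.List.Relation.Unary.Unique.Propositional.Properties as Unique
open import Data.Nat as ℕ using (ℕ; zero; suc; s≤s)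
import Data.Nat.Properties as ℕP
open import Data.Product using (Σ; _×_; _,_; proj₁; proj₂; map₁)
open import Data.Product.Properties using (≡-dec; ,-injectiveˡ; ,-injectiveʳ)
open import Data.Sum using (inj₁; inj₂)
open import Data.Unit using (⊤; tt)
open import Function using (id; _∘_; _⇔_; mk⇔; Equivalence; _⟨_⟩_)
open import Relation.Binary.Definitions using (DecidableEquality)
import Relation.Binary.PropositionalEquality as ≡
import Relation.Binary.Reasoning.Setoid as SetoidReasoning
open ≡ using (_≡_; _≢_)
open import Relation.Nullary using (¬_; Dec; yes; no; does)
open import Relation.Nullary.Decidable using (dec-true; ¬?; _×-dec_)
open import Relation.Unary using (Decidable)

module IntegerFacts where

  open import Data.Integer using (_+_; _-_)
  open ≡
  open GroupProperties (AbelianGroup.group ℤP.+-0-abelianGroup) using ()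
    renaming (∙-cancelˡ to +-cancelˡ)

  ≤-translate : ∀ c {a b a′ b′} → a ≤ b → c + a ≡ a′ → c + b ≡ b′ → a′ ≤ b′
  ≤-translate c a≤b refl refl = ℤP.+-monoʳ-≤ c a≤b

  reflect-involutive : ∀ L a → L - (L - a) ≡ a
  reflect-involutive = solve-∀

  reflect-≤⇔< : ∀ K d x → (K + + 1) - x ≤ K - d ⇔ d < x
  reflect-≤⇔< K d x = mk⇔
    (λ le → ℤP.suc[i]≤j⇒i<j (≤-translate ((x + d) - K) le (e₁ K d x) (e₂ K d x)))
    (λ lt → ≤-translate ((K - d) - x) (ℤP.i<j⇒suc[i]≤j lt) (e₃ K d x) (e₄ K d x))
    where
    e₁ : ∀ K d x → ((x + d) - K) + ((K + + 1) - x) ≡ + 1 + d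
    e₁ = solve-∀
    e₂ : ∀ K d x → ((x + d) - K) + (K - d) ≡ x
    e₂ = solve-∀
    e₃ : ∀ K d x → ((K - d) - x) + (+ 1 + d) ≡ (K + + 1) - x
    e₃ = solve-∀
    e₄ : ∀ K d x → ((K - d) - x) + x ≡ K - d
    e₄ = solve-∀

  ≤⇔reflect-≰ : ∀ K d x → x ≤ d ⇔ (¬ (K + + 1) - x ≤ K - d)
  ≤⇔reflect-≰ K d x = mk⇔
    (λ x≤d le → ℤP.<⇒≱ (to le) x≤d)
    (λ ≰ → ℤP.≮⇒≥ (≰ ∘ from))
    where open Equivalence (reflect-≤⇔< K d x)

  ≰⇔reflect-≤ : ∀ K d x → (¬ x ≤ d) ⇔ (K + + 1) - x ≤ K - d
  ≰⇔reflect-≤ K d x = mk⇔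
    (λ x≰d → from (ℤP.≰⇒> x≰d))
    (λ le → ℤP.<⇒≱ (to le))
    where open Equivalence (reflect-≤⇔< K d x)

  window : ℤ → ℕ → List ℤ
  window lo n = applyUpTo (λ i → lo + + i) n

  range-complete : ∀ {lo hi x} → lo ≤ x → x ≤ hi → x ∈ range lo hi
  range-complete {lo} {hi} {x} lo≤x x≤hi =
    subst (λ b → x ∈ (if b then window lo (suc ∣ hi - lo ∣) else []))
          (sym (dec-true (lo ≤? hi) (ℤP.≤-trans lo≤x x≤hi)))
          (subst (_∈ window lo (suc ∣ hi - lo ∣)) lo+∣x-lo∣≡x
                 (∈-applyUpTo⁺ (λ i → lo + + i) (s≤s ∣x-lo∣≤∣hi-lo∣)))
    where
    +∣-∣-nonneg : ∀ {a b} → a ≤ b → + ∣ b - a ∣ ≡ b - a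
    +∣-∣-nonneg a≤b = ℤP.0≤i⇒+∣i∣≡i (ℤP.i≤j⇒0≤j-i a≤b)
    a+[b-a]≡b : ∀ a b → a + (b - a) ≡ b
    a+[b-a]≡b = solve-∀
    lo+∣x-lo∣≡x : lo + + ∣ x - lo ∣ ≡ x
    lo+∣x-lo∣≡x = trans (cong (λ z → lo + z) (+∣-∣-nonneg lo≤x)) (a+[b-a]≡b lo x)
    ∣x-lo∣≤∣hi-lo∣ : ∣ x - lo ∣ ℕ.≤ ∣ hi - lo ∣
    ∣x-lo∣≤∣hi-lo∣ = ℤP.drop‿+≤+ (subst₂ _≤_
      (sym (+∣-∣-nonneg lo≤x)) (sym (+∣-∣-nonneg (ℤP.≤-trans lo≤x x≤hi)))
      (ℤP.+-monoˡ-≤ (ℤ.- lo) x≤hi))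

  range-unique : ∀ lo hi → Unique (range lo hi)
  range-unique lo hi = unique-if (does (lo ≤? hi))
    where
    unique-if : ∀ b → Unique (if b then window lo (suc ∣ hi - lo ∣) else [])
    unique-if true  = Unique.applyUpTo⁺₁ _ _ λ i<j _ eq →
      ℕP.<⇒≢ i<j (ℤP.+-injective (+-cancelˡ lo _ _ eq))
    unique-if false = []

module Enumeration where

  open IntegerFacts

  record Enumerates (S : List ℤ) (g : ℤ → ℤ) (P : ℤ → Set) : Set where
    field
      unique    : Unique S
      injective : ∀ {x y} → g x ≡ g y → x ≡ y
      sound     : ∀ {s} → s ∈ S → P (g s)
      complete  : ∀ {a} → P a → Σ ℤ λ s → s ∈ S × g s ≡ a

  enumerate : {P : ℤ → Set} → Decidable P → ∀ lo hi → (∀ {a} → P a → lo ≤ a × a ≤ hi) →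
              Σ (List ℤ) λ S → Enumerates S id P
  enumerate P? lo hi bounded = filter P? (range lo hi) , record
    { unique    = Unique.filter⁺ P? (range-unique lo hi)
    ; injective = id
    ; sound     = λ s∈ → proj₂ (∈-filter⁻ P? {xs = range lo hi} s∈)
    ; complete  = λ {a} p →
        let lo≤a , a≤hi = bounded p in a , ∈-filter⁺ P? (range-complete lo≤a a≤hi) p , ≡.refl
    }

  reindex : ∀ {S P Q} (g : ℤ → ℤ) → (∀ a → g (g a) ≡ a) → (∀ a → P a ⇔ Q (g a)) →
            Enumerates S id P → Enumerates S g Q
  reindex {Q = Q} g g∘g P⇔Q E = record
    { unique    = unique
    ; injective = λ {x} {y} gx≡gy → ≡.trans (≡.sym (g∘g x)) (≡.trans (≡.cong g gx≡gy) (g∘g y))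
    ; sound     = λ {s} s∈ → Equivalence.to (P⇔Q s) (sound s∈)
    ; complete  = λ {a} q →
        let s , s∈ , s≡ga = complete (Equivalence.from (P⇔Q _) (≡.subst Q (≡.sym (g∘g a)) q))
        in s , s∈ , ≡.trans (≡.cong g s≡ga) (g∘g a)
    }
    where open Enumerates E

module FieldAlgebra (k : Field) where

  open Field k hiding (zero)
  open AbelianGroupProperties +-abelianGroup public
    using (⁻¹-involutive; x∙y⁻¹≈ε⇒x≈y; x≈y⇒x∙y⁻¹≈ε; ⁻¹-∙-comm)
  open CommutativeSemigroupProperties +-commutativeSemigroup public
    using (interchange)
  open RingProperties ring public using (-0#≈0#; x[y-z]≈xy-xz)
  open GroupProperties +-group public using () renaming (//-cong₂ to -‿cong₂)

  x-0≈x : ∀ x → x - 0# ≈ x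
  x-0≈x x = trans (+-congˡ -0#≈0#) (+-identityʳ x)

  0-0≈0 : 0# - 0# ≈ 0#
  0-0≈0 = x-0≈x 0#

  x-x≈0 : ∀ x → x - x ≈ 0#
  x-x≈0 x = x≈y⇒x∙y⁻¹≈ε refl

  -‿+-interchange : ∀ a b c d → (a + b) - (c + d) ≈ (a - c) + (b - d)
  -‿+-interchange a b c d =
    trans (+-congˡ (sym (⁻¹-∙-comm c d))) (interchange a b (- c) (- d))

  when : {Q : Set} → Dec Q → Carrier → Carrier
  when (yes _) c = c
  when (no _)  _ = 0#

  when-⇔ : {Q R : Set} (d : Dec Q) (e : Dec R) → Q ⇔ R → ∀ c → when d c ≈ when e c
  when-⇔ (yes _) (yes _) _   _ = refl
  when-⇔ (yes q) (no ¬r) Q⇔R _ = ⊥-elim (¬r (Equivalence.to Q⇔R q))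
  when-⇔ (no ¬q) (yes r) Q⇔R _ = ⊥-elim (¬q (Equivalence.from Q⇔R r))
  when-⇔ (no _)  (no _)  _   _ = refl

  *-when-1 : {Q : Set} (d : Dec Q) → ∀ c → c * when d 1# ≈ when d c
  *-when-1 (yes _) c = *-identityʳ c
  *-when-1 (no _)  c = zeroʳ c

  -‿when-‿ : {Q : Set} (d : Dec Q) → ∀ c → - when d (- c) ≈ when d c
  -‿when-‿ (yes _) c = ⁻¹-involutive c
  -‿when-‿ (no _)  c = -0#≈0#

  when-¬ : {Q : Set} (d : Dec Q) → ¬ Q → ∀ c → when d c ≈ 0#
  when-¬ (yes q) ¬q _ = ⊥-elim (¬q q)
  when-¬ (no _)  _  _ = refl

  ∑ : {A : Set} → List A → (A → Carrier) → Carrier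
  ∑ []       f = 0#
  ∑ (x ∷ xs) f = f x + ∑ xs f

  syntax ∑ xs (λ x → e) = ∑[ x ← xs ] e

  ∑-cong∈ : {A : Set} (xs : List A) {f g : A → Carrier} →
            (∀ {x} → x ∈ xs → f x ≈ g x) → ∑ xs f ≈ ∑ xs g
  ∑-cong∈ []       _   = refl
  ∑-cong∈ (x ∷ xs) f≈g = +-cong (f≈g (here ≡.refl)) (∑-cong∈ xs (f≈g ∘ there))

  ∑-cong : {A : Set} (xs : List A) {f g : A → Carrier} →
           (∀ x → f x ≈ g x) → ∑ xs f ≈ ∑ xs g
  ∑-cong xs f≈g = ∑-cong∈ xs (λ {x} _ → f≈g x)

  ∑-zero : {A : Set} (xs : List A) {f : A → Carrier} →
           (∀ {x} → x ∈ xs → f x ≈ 0#) → ∑ xs f ≈ 0#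
  ∑-zero []       _    = refl
  ∑-zero (x ∷ xs) f≈0 =
    trans (+-cong (f≈0 (here ≡.refl)) (∑-zero xs (λ x∈ → f≈0 (there x∈)))) (+-identityʳ 0#)

  ∑-+ : {A : Set} (xs : List A) (f g : A → Carrier) →
        ∑[ x ← xs ] (f x + g x) ≈ ∑ xs f + ∑ xs g
  ∑-+ []       f g = sym (+-identityʳ 0#)
  ∑-+ (x ∷ xs) f g = trans (+-congˡ (∑-+ xs f g)) (interchange (f x) (g x) _ _)

  ∑-neg : {A : Set} (xs : List A) (f : A → Carrier) → ∑[ x ← xs ] (- f x) ≈ - ∑ xs f
  ∑-neg []       f = sym -0#≈0#
  ∑-neg (x ∷ xs) f =
    trans (+-congˡ (∑-neg xs f)) (⁻¹-∙-comm (f x) (∑ xs f))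

  ∑-* : {A : Set} (xs : List A) (c : Carrier) (f : A → Carrier) →
        ∑[ x ← xs ] (c * f x) ≈ c * ∑ xs f
  ∑-* []       c f = sym (zeroʳ c)
  ∑-* (x ∷ xs) c f = trans (+-congˡ (∑-* xs c f)) (sym (distribˡ c (f x) (∑ xs f)))

  ∑-when-≡ : {A : Set} (_≟_ : DecidableEquality A) {xs : List A} → Unique xs →
             ∀ {t} → t ∈ xs → (c : A → Carrier) → ∑[ s ← xs ] when (s ≟ t) (c s) ≈ c t
  ∑-when-≡ _≟_ {x ∷ xs} (x∉xs ∷ _) (here ≡.refl) c with x ≟ x
  ... | no x≢x = ⊥-elim (x≢x ≡.refl)
  ... | yes _  = trans (+-congˡ (∑-zero xs vanish)) (+-identityʳ (c x))
    where
    vanish : ∀ {s} → s ∈ xs → when (s ≟ x) (c s) ≈ 0#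
    vanish {s} s∈xs = when-¬ (s ≟ x) (λ { ≡.refl → lookup x∉xs s∈xs ≡.refl }) (c s)
  ∑-when-≡ _≟_ {x ∷ xs} (x∉xs ∷ xs!) {t} (there t∈xs) c with x ≟ t
  ... | yes ≡.refl = ⊥-elim (lookup x∉xs t∈xs ≡.refl)
  ... | no _       = trans (+-identityˡ _) (∑-when-≡ _≟_ xs! t∈xs c)

module TaggedUnion where

  tagged : ∀ {n} {I : Set} → (Fin n → List I) → List (Fin n × I)
  tagged {zero}  S = []
  tagged {suc n} S = map (zero ,_) (S zero) ++ map (map₁ suc) (tagged (S ∘ suc))

  ∈-tagged⁺ : ∀ {n} {I : Set} (S : Fin n → List I) {r a} → a ∈ S r → (r , a) ∈ tagged S
  ∈-tagged⁺ S {zero}  a∈ = ∈-++⁺ˡ (∈-map⁺ (zero ,_) a∈)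
  ∈-tagged⁺ S {suc r} a∈ = ∈-++⁺ʳ (map (zero ,_) (S zero)) (∈-map⁺ (map₁ suc) (∈-tagged⁺ (S ∘ suc) a∈))

  ∈-tagged⁻ : ∀ {n} {I : Set} (S : Fin n → List I) {r a} → (r , a) ∈ tagged S → a ∈ S r
  ∈-tagged⁻ {suc n} S ra∈ with ∈-++⁻ (map (zero ,_) (S zero)) ra∈
  ... | inj₁ ∈head with ∈-map⁻ (zero ,_) ∈head
  ...   | _ , a∈ , ≡.refl = a∈
  ∈-tagged⁻ {suc n} S ra∈ | inj₂ ∈tail with ∈-map⁻ (map₁ suc) ∈tail
  ...   | _ , ra∈′ , ≡.refl = ∈-tagged⁻ (S ∘ suc) ra∈′

  tagged-unique : ∀ {n} {I : Set} (S : Fin n → List I) → (∀ r → Unique (S r)) → Unique (tagged S)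
  tagged-unique {zero}  S S! = []
  tagged-unique {suc n} S S! = Unique.++⁺
    (Unique.map⁺ (λ { ≡.refl → ≡.refl }) (S! zero))
    (Unique.map⁺ (λ { {_ , _} {_ , _} ≡.refl → ≡.refl }) (tagged-unique (S ∘ suc) (S! ∘ suc)))
    disjoint
    where
    disjoint : ∀ {v} → ¬ (v ∈ map (zero ,_) (S zero) × v ∈ map (map₁ suc) (tagged (S ∘ suc)))
    disjoint (∈head , ∈tail) with ∈-map⁻ (zero ,_) ∈head | ∈-map⁻ (map₁ suc) ∈tail
    ... | _ , _ , ≡.refl | _ , _ , ()

module Bases (k : Field) where

  open Field k hiding (zero)
  open FieldAlgebra k
  open LinearAlgebra k
  open TaggedUnion

  -- The spaces of Defs carry no axioms, so a basis indexed by a duplicate-free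
  -- list S is given by its coordinate functionals: linear, jointly injective
  -- on S, with a section `fromCoords`, on a subset closed under the operations.
  record Basis (V : Space) {I : Set} (S : List I) : Set where
    private module V = Space V
    field
      coord            : I → (x : V.Carrier) → V.In x → Carrier
      coord-cong       : ∀ {s} → s ∈ S → ∀ x y p q → x V.≈ y → coord s x p ≈ coord s y q
      coord-+          : ∀ s x y p q r → coord s (x V.+ y) r ≈ coord s x p + coord s y q
      coord-·          : ∀ s c x p r → coord s (c V.· x) r ≈ c * coord s x p
      +-closed         : ∀ x y → V.In x → V.In y → V.In (x V.+ y)
      ·-closed         : ∀ c x → V.In x → V.In (c V.· x)
      coord-injective  : ∀ x y p q → (∀ {s} → s ∈ S → coord s x p ≈ coord s y q) → x V.≈ y
      fromCoords       : (I → Carrier) → V.Carrier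
      fromCoords-in    : ∀ c → V.In (fromCoords c)
      coord-fromCoords : ∀ c {t} → t ∈ S → coord t (fromCoords c) (fromCoords-in c) ≈ c t

  module BasisProperties {V : Space} {I : Set} {S : List I} (B : Basis V S) where
    open Basis B
    private module V = Space V

    fromCoords-cong : ∀ {c c′} → (∀ {t} → t ∈ S → c t ≈ c′ t) → fromCoords c V.≈ fromCoords c′
    fromCoords-cong c≈c′ = coord-injective _ _ _ _ λ t∈S →
      trans (coord-fromCoords _ t∈S) (trans (c≈c′ t∈S) (sym (coord-fromCoords _ t∈S)))

    fromCoords-injective : ∀ {c c′} → fromCoords c V.≈ fromCoords c′ →
                           ∀ {t} → t ∈ S → c t ≈ c′ t
    fromCoords-injective c≈c′ t∈S = trans (sym (coord-fromCoords _ t∈S))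
      (trans (coord-cong t∈S _ _ _ _ c≈c′) (coord-fromCoords _ t∈S))

    fromCoords-+ : ∀ c c′ → fromCoords (λ s → c s + c′ s) V.≈ (fromCoords c V.+ fromCoords c′)
    fromCoords-+ c c′ = coord-injective _ _ _ (+-closed _ _ (fromCoords-in c) (fromCoords-in c′))
      λ t∈S → trans (coord-fromCoords _ t∈S)
        (sym (trans (coord-+ _ _ _ (fromCoords-in c) (fromCoords-in c′) _)
                    (+-cong (coord-fromCoords c t∈S) (coord-fromCoords c′ t∈S))))

    fromCoords-· : ∀ a c → fromCoords (λ s → a * c s) V.≈ (a V.· fromCoords c)
    fromCoords-· a c = coord-injective _ _ _ (·-closed a _ (fromCoords-in c)) λ t∈S →
      trans (coord-fromCoords _ t∈S) (sym (trans (coord-· _ a _ (fromCoords-in c) _)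
                                                 (*-congˡ (coord-fromCoords c t∈S))))

  module DualBasis {V W : Space} {I : Set} (_≟_ : DecidableEquality I)
                   {S : List I} (S! : Unique S) (BV : Basis V S) (BW : Basis W S) where
    private
      module V = Space V
      module W = Space W
      module BV = Basis BV
      module BW = Basis BW
      module PW = BasisProperties BW

    ∑-*-when-≡ : ∀ {t} → t ∈ S → (c : I → Carrier) → ∑[ s ← S ] (c s * when (t ≟ s) 1#) ≈ c t
    ∑-*-when-≡ {t} t∈S c = trans
      (∑-cong S λ s → trans (*-when-1 (t ≟ s) (c s)) (when-⇔ (t ≟ s) (s ≟ t) (mk⇔ ≡.sym ≡.sym) (c s)))
      (∑-when-≡ _≟_ S! t∈S c)

    e : I → V.Carrier
    e s = BV.fromCoords λ t → when (t ≟ s) 1#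

    e-in : ∀ s → V.In (e s)
    e-in s = BV.fromCoords-in _

    o : V.Carrier
    o = BV.fromCoords λ _ → 0#

    o-in : V.In o
    o-in = BV.fromCoords-in _

    combination : List I → (I → Carrier) → V.Carrier
    combination []      c = o
    combination (s ∷ T) c = (c s V.· e s) V.+ combination T c

    combination-in : ∀ T c → V.In (combination T c)
    combination-in []      c = o-in
    combination-in (s ∷ T) c =
      BV.+-closed _ _ (BV.·-closed (c s) (e s) (e-in s)) (combination-in T c)

    coord-combination : ∀ {t} → t ∈ S → ∀ T c →
      BV.coord t (combination T c) (combination-in T c) ≈ ∑[ s ← T ] (c s * when (t ≟ s) 1#)
    coord-combination t∈S []      c = BV.coord-fromCoords _ t∈S
    coord-combination t∈S (s ∷ T) c = trans
      (BV.coord-+ _ _ _ (BV.·-closed (c s) (e s) (e-in s)) (combination-in T c) _)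
      (+-cong (trans (BV.coord-· _ (c s) (e s) (e-in s) _) (*-congˡ (BV.coord-fromCoords _ t∈S)))
              (coord-combination t∈S T c))

    expansion : ∀ x p → x V.≈ combination S (λ s → BV.coord s x p)
    expansion x p = BV.coord-injective x _ p (combination-in S _) λ t∈S →
      sym (trans (coord-combination t∈S S _) (∑-*-when-≡ t∈S _))

    module _ (φ : (x : V.Carrier) → V.In x → Carrier) (φ-linear : IsLinearFunctional V φ) where
      private
        φ-cong = proj₁ φ-linear
        φ-+    = proj₁ (proj₂ φ-linear)
        φ-·    = proj₂ (proj₂ φ-linear)

      φ-o : φ o o-in ≈ 0#
      φ-o = begin
        φ o o-in         ≈⟨ φ-cong o _ o-in 0·o-in (BV.coord-injective o _ o-in 0·o-in λ t∈S →
                              trans (BV.coord-fromCoords _ t∈S)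
                                    (sym (trans (BV.coord-· _ 0# o o-in _) (zeroˡ _)))) ⟩
        φ (0# V.· o) _   ≈⟨ φ-· 0# o o-in _ ⟩
        0# * φ o o-in    ≈⟨ zeroˡ _ ⟩
        0#               ∎
        where
        open SetoidReasoning setoid
        0·o-in = BV.·-closed 0# o o-in

      φ-combination : ∀ T c → φ (combination T c) (combination-in T c) ≈
                              ∑[ s ← T ] (c s * φ (e s) (e-in s))
      φ-combination []      c = φ-o
      φ-combination (s ∷ T) c = trans
        (φ-+ _ _ (BV.·-closed (c s) (e s) (e-in s)) (combination-in T c) _)
        (+-cong (φ-· (c s) (e s) (e-in s) _) (φ-combination T c))

      φ-expansion : ∀ x p → φ x p ≈ ∑[ s ← S ] (BV.coord s x p * φ (e s) (e-in s))
      φ-expansion x p = trans (φ-cong x _ p (combination-in S _) (expansion x p)) (φ-combination S _)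

    valuesOnBasis : ((x : V.Carrier) → V.In x → Carrier) → W.Carrier
    valuesOnBasis φ = BW.fromCoords λ s → φ (e s) (e-in s)

    valuesOnBasis-injective : ∀ φ ψ → IsLinearFunctional V φ → IsLinearFunctional V ψ →
                              valuesOnBasis φ W.≈ valuesOnBasis ψ → ∀ x p → φ x p ≈ ψ x p
    valuesOnBasis-injective φ ψ φ-linear ψ-linear φ≈ψ x p = begin
      φ x p
        ≈⟨ φ-expansion φ φ-linear x p ⟩
      ∑[ s ← S ] (BV.coord s x p * φ (e s) (e-in s))
        ≈⟨ ∑-cong∈ S (*-congˡ ∘ PW.fromCoords-injective φ≈ψ) ⟩
      ∑[ s ← S ] (BV.coord s x p * ψ (e s) (e-in s))
        ≈⟨ φ-expansion ψ ψ-linear x p ⟨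
      ψ x p
        ∎
      where open SetoidReasoning setoid

    valuesOnBasis-surjective : ∀ w → W.In w → Σ ((x : V.Carrier) → V.In x → Carrier) λ φ →
                               Σ (IsLinearFunctional V φ) λ _ → valuesOnBasis φ W.≈ w
    valuesOnBasis-surjective w q = φ , φ-linear , BW.coord-injective _ _ (BW.fromCoords-in _) q values
      where
      φ : (x : V.Carrier) → V.In x → Carrier
      φ x p = ∑[ s ← S ] (BW.coord s w q * BV.coord s x p)
      φ-linear : IsLinearFunctional V φ
      φ-linear =
          (λ x y p p′ x≈y → ∑-cong∈ S λ s∈S → *-congˡ (BV.coord-cong s∈S x y p p′ x≈y))
        , (λ x y p p′ r → trans
             (∑-cong S λ s → trans (*-congˡ (BV.coord-+ s x y p p′ r)) (distribˡ _ _ _))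
             (∑-+ S _ _))
        , (λ c x p r → trans
             (∑-cong S λ s → trans (*-congˡ (BV.coord-· s c x p r))
               (trans (sym (*-assoc _ _ _)) (trans (*-congʳ (*-comm _ _)) (*-assoc _ _ _))))
             (∑-* S c _))
      values : ∀ {t} → t ∈ S → BW.coord t (valuesOnBasis φ) (BW.fromCoords-in _) ≈ BW.coord t w q
      values {t} t∈S = trans (BW.coord-fromCoords _ t∈S)
        (trans (∑-cong∈ S λ s∈S → *-congˡ (BV.coord-fromCoords _ s∈S))
        (trans (∑-cong S λ s → *-when-1 (s ≟ t) _) (∑-when-≡ _≟_ S! t∈S (λ s → BW.coord s w q))))

    dual≅ : LinearIso (Dual V) W
    dual≅ = record
      { f          = λ φ _ → valuesOnBasis φ
      ; f-in       = λ _ _ → BW.fromCoords-in _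
      ; f-cong     = λ _ _ _ _ φ≈ψ → PW.fromCoords-cong λ _ → φ≈ψ _ _
      ; f-+        = λ φ ψ _ _ _ → PW.fromCoords-+ _ _
      ; f-·        = λ c φ _ _ → PW.fromCoords-· c _
      ; injective  = valuesOnBasis-injective
      ; surjective = valuesOnBasis-surjective
      }

  ⨁-basis : ∀ {n} {I : Set} {V : Fin n → Space} (S : Fin n → List I) →
            (∀ r → Basis (V r) (S r)) → Basis (⨁ V) (tagged S)
  ⨁-basis S B = record
    { coord            = λ (r , a) x p → B.coord r a (x r) (p r)
    ; coord-cong       = λ {(r , a)} ra∈ x y p q x≈y → B.coord-cong r (∈-tagged⁻ S ra∈) _ _ _ _ (x≈y r)
    ; coord-+          = λ (r , a) x y p q s → B.coord-+ r a _ _ _ _ _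
    ; coord-·          = λ (r , a) c x p s → B.coord-· r a _ _ _ _
    ; +-closed         = λ x y p q r → B.+-closed r _ _ (p r) (q r)
    ; ·-closed         = λ c x p r → B.·-closed r c _ (p r)
    ; coord-injective  = λ x y p q agree r → B.coord-injective r _ _ _ _ λ a∈ → agree (∈-tagged⁺ S a∈)
    ; fromCoords       = λ c r → B.fromCoords r λ a → c (r , a)
    ; fromCoords-in    = λ c r → B.fromCoords-in r _
    ; coord-fromCoords = λ c {(r , a)} ra∈ → B.coord-fromCoords r _ (∈-tagged⁻ S ra∈)
    }
    where module B r = Basis (B r)

module Coefficients (k : Field) {I : Set} (_≟_ : DecidableEquality I) (P : I → Set) where

  open Field k hiding (zero)
  open FieldAlgebra k
  open LinearAlgebra k
  open FreeSpace _≟_ P public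

  Entries : Set
  Entries = List (Index × Carrier)

  coeff-∷ : ∀ s c xs i → coeff ((s , c) ∷ xs) i ≈ when (proj₁ s ≟ i) c + coeff xs i
  coeff-∷ s c xs i with proj₁ s ≟ i
  ... | yes _ = refl
  ... | no _  = sym (+-identityˡ _)

  coeff-single : ∀ s c i → coeff ((s , c) ∷ []) i ≈ when (proj₁ s ≟ i) c
  coeff-single s c i = trans (coeff-∷ s c [] i) (+-identityʳ _)

  coeff-∑ : ∀ xs i → coeff xs i ≈ ∑[ t ← xs ] when (proj₁ (proj₁ t) ≟ i) (proj₂ t)
  coeff-∑ []             i = refl
  coeff-∑ ((s , c) ∷ xs) i = trans (coeff-∷ s c xs i) (+-congˡ (coeff-∑ xs i))

  coeff-++ : ∀ xs ys i → coeff (xs ++ ys) i ≈ coeff xs i + coeff ys i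
  coeff-++ []             ys i = sym (+-identityˡ _)
  coeff-++ ((s , c) ∷ xs) ys i = trans (coeff-∷ s c (xs ++ ys) i)
    (trans (+-congˡ (coeff-++ xs ys i))
    (trans (sym (+-assoc _ _ _)) (+-congʳ (sym (coeff-∷ s c xs i)))))

  coeff-neg : ∀ xs i → coeff (map (λ t → proj₁ t , - proj₂ t) xs) i ≈ - coeff xs i
  coeff-neg []             i = sym -0#≈0#
  coeff-neg ((s , c) ∷ xs) i with proj₁ s ≟ i
  ... | yes _ = trans (+-congˡ (coeff-neg xs i)) (⁻¹-∙-comm _ _)
  ... | no _  = coeff-neg xs i

  coeff-· : ∀ a xs i → coeff (map (λ t → proj₁ t , a * proj₂ t) xs) i ≈ a * coeff xs i
  coeff-· a []             i = sym (zeroʳ a)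
  coeff-· a ((s , c) ∷ xs) i with proj₁ s ≟ i
  ... | yes _ = trans (+-congˡ (coeff-· a xs i)) (sym (distribˡ _ _ _))
  ... | no _  = coeff-· a xs i

  coeff-absent : ∀ xs {i} → (∀ (s : Index) → proj₁ s ≢ i) → coeff xs i ≈ 0#
  coeff-absent []             _      = refl
  coeff-absent ((s , c) ∷ xs) {i} absent with proj₁ s ≟ i
  ... | yes s≡i = ⊥-elim (absent s s≡i)
  ... | no _    = coeff-absent xs absent

  tabulate : {A : Set} (S : List A) (idx : A → I) → (∀ {s} → s ∈ S → P (idx s)) →
             (A → Carrier) → Entries
  tabulate []      idx ok c = []
  tabulate (s ∷ S) idx ok c = ((idx s , ok (here ≡.refl)) , c s) ∷ tabulate S idx (ok ∘ there) c

  coeff-tabulate : {A : Set} (S : List A) (idx : A → I) (ok : ∀ {s} → s ∈ S → P (idx s))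
                   (c : A → Carrier) (i : I) →
                   coeff (tabulate S idx ok c) i ≈ ∑[ s ← S ] when (idx s ≟ i) (c s)
  coeff-tabulate []      idx ok c i = refl
  coeff-tabulate (s ∷ S) idx ok c i =
    trans (coeff-∷ _ (c s) _ i) (+-congˡ (coeff-tabulate S idx (ok ∘ there) c i))

  coeff-induced : {J : Set} (_≟J_ : DecidableEquality J) (Q : J → Set)
                  (φ : Σ J Q → Index) (h : I → J) →
                  (∀ s i → proj₁ (φ s) ≡ i ⇔ proj₁ s ≡ h i) →
                  ∀ xs i → coeff (induced φ xs) i ≈ FreeSpace.coeff _≟J_ Q xs (h i)
  coeff-induced _≟J_ Q φ h φ⇔h []             i = refl
  coeff-induced _≟J_ Q φ h φ⇔h ((s , c) ∷ xs) i
    with proj₁ (φ s) ≟ i | proj₁ s ≟J h i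
  ... | yes _    | yes _    = +-congˡ (coeff-induced _≟J_ Q φ h φ⇔h xs i)
  ... | no _     | no _     = coeff-induced _≟J_ Q φ h φ⇔h xs i
  ... | yes φs≡i | no s≢hi  = ⊥-elim (s≢hi (Equivalence.to (φ⇔h s i) φs≡i))
  ... | no φs≢i  | yes s≡hi = ⊥-elim (φs≢i (Equivalence.from (φ⇔h s i) s≡hi))

module MatchingDiagram (k : Field) (W : ℤ → ℤ → ℤ) (pm : IsPerfectMatching W) (d₁ d₂ : ℤ) where

  open Field k hiding (zero)
  open FieldAlgebra k
  open LinearAlgebra k
  open Bases k
  open Enumeration using (Enumerates)
  open IsPerfectMatching pm public using (π)
  open IsPerfectMatching pm using (π-bij)

  D : Diagram
  D = M W pm (d₁ , d₂)

  open Diagram D using (B; A; ρ₁₁; ρ₂₂; ρ₃₁; ρ₃₂; ∂; H⁰; H¹)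

  _≟²_ : DecidableEquality (ℤ × ℤ)
  _≟²_ = ≡-dec ℤ._≟_ ℤ._≟_

  module C₁ = Coefficients k ℤ._≟_ (_≤ d₁)
  module C₂ = Coefficients k ℤ._≟_ (_≤ d₂)
  module C₃ = Coefficients k _≟²_ (λ p → proj₂ p ≡ π (proj₁ p))
  module Cᴬ = Coefficients k ℤ._≟_ (λ _ → ⊤)

  π⁻¹ : ℤ → ℤ
  π⁻¹ j = proj₁ (proj₂ π-bij j)

  π∘π⁻¹ : ∀ j → π (π⁻¹ j) ≡ j
  π∘π⁻¹ j = proj₂ (proj₂ π-bij j) ≡.refl

  π⁻¹∘π : ∀ a → π⁻¹ (π a) ≡ a
  π⁻¹∘π a = proj₁ π-bij (π∘π⁻¹ (π a))

  Lower Upper : ℤ → Set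
  Lower a = a ≤ d₁ × π a ≤ d₂
  Upper a = ¬ a ≤ d₁ × ¬ π a ≤ d₂

  lower? : ∀ a → Dec (Lower a)
  lower? a = a ≤? d₁ ×-dec π a ≤? d₂

  upper? : ∀ a → Dec (Upper a)
  upper? a = ¬? (a ≤? d₁) ×-dec ¬? (π a ≤? d₂)

  graphCoeff : C₃.Entries → ℤ → Carrier
  graphCoeff b₃ a = C₃.coeff b₃ (a , π a)

  ∂₁ᶜ ∂₂ᶜ : Space.Carrier B → ℤ → Carrier
  ∂₁ᶜ (b₁ , _ , b₃) i = C₁.coeff b₁ i - graphCoeff b₃ i
  ∂₂ᶜ (_ , b₂ , b₃) j = C₂.coeff b₂ j - C₃.coeff b₃ (π⁻¹ j , j)

  coeff-ρ₁₁ : ∀ b₁ i → Cᴬ.coeff (ρ₁₁ b₁) i ≈ C₁.coeff b₁ i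
  coeff-ρ₁₁ = Cᴬ.coeff-induced ℤ._≟_ _ _ (λ i → i) λ _ _ → mk⇔ id id

  coeff-ρ₂₂ : ∀ b₂ j → Cᴬ.coeff (ρ₂₂ b₂) j ≈ C₂.coeff b₂ j
  coeff-ρ₂₂ = Cᴬ.coeff-induced ℤ._≟_ _ _ (λ j → j) λ _ _ → mk⇔ id id

  coeff-ρ₃₁ : ∀ b₃ i → Cᴬ.coeff (ρ₃₁ b₃) i ≈ graphCoeff b₃ i
  coeff-ρ₃₁ = Cᴬ.coeff-induced _≟²_ _ _ (λ i → i , π i) λ where
    ((a , b) , b≡πa) i → mk⇔ (λ { ≡.refl → ≡.cong (a ,_) b≡πa }) (,-injectiveˡ)

  coeff-ρ₃₂ : ∀ b₃ j → Cᴬ.coeff (ρ₃₂ b₃) j ≈ C₃.coeff b₃ (π⁻¹ j , j)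
  coeff-ρ₃₂ = Cᴬ.coeff-induced _≟²_ _ _ (λ j → π⁻¹ j , j) λ where
    ((a , b) , b≡πa) j → mk⇔
      (λ { ≡.refl → ≡.cong (_, b) (≡.trans (≡.sym (π⁻¹∘π a)) (≡.cong π⁻¹ (≡.sym b≡πa))) })
      (,-injectiveʳ)

  coeff-∂₁ : ∀ b i → Cᴬ.coeff (proj₁ (∂ b)) i ≈ ∂₁ᶜ b i
  coeff-∂₁ (b₁ , _ , b₃) i = trans (Cᴬ.coeff-++ (ρ₁₁ b₁) _ i)
    (+-cong (coeff-ρ₁₁ b₁ i) (trans (Cᴬ.coeff-neg (ρ₃₁ b₃) i) (-‿cong (coeff-ρ₃₁ b₃ i))))

  coeff-∂₂ : ∀ b j → Cᴬ.coeff (proj₂ (∂ b)) j ≈ ∂₂ᶜ b j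
  coeff-∂₂ (_ , b₂ , b₃) j = trans (Cᴬ.coeff-++ (ρ₂₂ b₂) _ j)
    (+-cong (coeff-ρ₂₂ b₂ j) (trans (Cᴬ.coeff-neg (ρ₃₂ b₃) j) (-‿cong (coeff-ρ₃₂ b₃ j))))

  coeff₁-vanishes : ∀ b₁ {i} → ¬ i ≤ d₁ → C₁.coeff b₁ i ≈ 0#
  coeff₁-vanishes b₁ i≰ = C₁.coeff-absent b₁ λ (_ , s≤) s≡i → i≰ (≡.subst (_≤ d₁) s≡i s≤)

  coeff₂-vanishes : ∀ b₂ {j} → ¬ j ≤ d₂ → C₂.coeff b₂ j ≈ 0#
  coeff₂-vanishes b₂ j≰ = C₂.coeff-absent b₂ λ (_ , s≤) s≡j → j≰ (≡.subst (_≤ d₂) s≡j s≤)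

  private
    module B = Space B
    module A = Space A

  ∂₁ᶜ-+ : ∀ b b′ i → ∂₁ᶜ (b B.+ b′) i ≈ ∂₁ᶜ b i + ∂₁ᶜ b′ i
  ∂₁ᶜ-+ (b₁ , _ , b₃) (b₁′ , _ , b₃′) i =
    trans (-‿cong₂ (C₁.coeff-++ b₁ b₁′ i) (C₃.coeff-++ b₃ b₃′ _)) (-‿+-interchange _ _ _ _)

  ∂₂ᶜ-+ : ∀ b b′ j → ∂₂ᶜ (b B.+ b′) j ≈ ∂₂ᶜ b j + ∂₂ᶜ b′ j
  ∂₂ᶜ-+ (_ , b₂ , b₃) (_ , b₂′ , b₃′) j =
    trans (-‿cong₂ (C₂.coeff-++ b₂ b₂′ j) (C₃.coeff-++ b₃ b₃′ _)) (-‿+-interchange _ _ _ _)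

  ∂₁ᶜ-· : ∀ c b i → ∂₁ᶜ (c B.· b) i ≈ c * ∂₁ᶜ b i
  ∂₁ᶜ-· c (b₁ , _ , b₃) i =
    trans (-‿cong₂ (C₁.coeff-· c b₁ i) (C₃.coeff-· c b₃ _)) (sym (x[y-z]≈xy-xz _ _ _))

  ∂₂ᶜ-· : ∀ c b j → ∂₂ᶜ (c B.· b) j ≈ c * ∂₂ᶜ b j
  ∂₂ᶜ-· c (_ , b₂ , b₃) j =
    trans (-‿cong₂ (C₂.coeff-· c b₂ j) (C₃.coeff-· c b₃ _)) (sym (x[y-z]≈xy-xz _ _ _))

  IsCycle : Space.Carrier B → Set
  IsCycle b = (∀ i → ∂₁ᶜ b i ≈ 0#) × (∀ j → ∂₂ᶜ b j ≈ 0#)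

  ∂≈0⇒IsCycle : ∀ b → ∂ b A.≈ A.0v → IsCycle b
  ∂≈0⇒IsCycle b (∂₁≈0 , ∂₂≈0) =
    (λ i → trans (sym (coeff-∂₁ b i)) (∂₁≈0 i)) , (λ j → trans (sym (coeff-∂₂ b j)) (∂₂≈0 j))

  IsCycle⇒∂≈0 : ∀ b → IsCycle b → ∂ b A.≈ A.0v
  IsCycle⇒∂≈0 b (∂₁≈0 , ∂₂≈0) =
    (λ i → trans (coeff-∂₁ b i) (∂₁≈0 i)) , (λ j → trans (coeff-∂₂ b j) (∂₂≈0 j))

  IsCycle-+ : ∀ b b′ → IsCycle b → IsCycle b′ → IsCycle (b B.+ b′)
  IsCycle-+ b b′ (z₁ , z₂) (z₁′ , z₂′) =
      (λ i → trans (∂₁ᶜ-+ b b′ i) (trans (+-cong (z₁ i) (z₁′ i)) (+-identityʳ 0#)))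
    , (λ j → trans (∂₂ᶜ-+ b b′ j) (trans (+-cong (z₂ j) (z₂′ j)) (+-identityʳ 0#)))

  IsCycle-· : ∀ c b → IsCycle b → IsCycle (c B.· b)
  IsCycle-· c b (z₁ , z₂) =
      (λ i → trans (∂₁ᶜ-· c b i) (trans (*-congˡ (z₁ i)) (zeroʳ c)))
    , (λ j → trans (∂₂ᶜ-· c b j) (trans (*-congˡ (z₂ j)) (zeroʳ c)))

  coeff₃-off-graph : ∀ b₃ a b → b ≢ π a → C₃.coeff b₃ (a , b) ≈ 0#
  coeff₃-off-graph b₃ a b b≢πa = C₃.coeff-absent b₃ λ (_ , on-graph) → λ { ≡.refl → b≢πa on-graph }

  module CycleCoefficients (b₁ : C₁.Entries) (b₂ : C₂.Entries) (b₃ : C₃.Entries)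
                           (cycle : IsCycle (b₁ , b₂ , b₃)) where

    coeff₁≈graphCoeff : ∀ i → C₁.coeff b₁ i ≈ graphCoeff b₃ i
    coeff₁≈graphCoeff i = x∙y⁻¹≈ε⇒x≈y _ _ (proj₁ cycle i)

    coeff₂≈graphCoeff : ∀ a → C₂.coeff b₂ (π a) ≈ graphCoeff b₃ a
    coeff₂≈graphCoeff a = trans (x∙y⁻¹≈ε⇒x≈y _ _ (proj₂ cycle (π a)))
                       (reflexive (≡.cong (λ x → C₃.coeff b₃ (x , π a)) (π⁻¹∘π a)))

    graphCoeff-vanishes : ∀ a → ¬ Lower a → graphCoeff b₃ a ≈ 0#
    graphCoeff-vanishes a ¬lower with a ≤? d₁ | π a ≤? d₂
    ... | yes a≤ | yes πa≤ = ⊥-elim (¬lower (a≤ , πa≤))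
    ... | no a≰  | _       = trans (sym (coeff₁≈graphCoeff a)) (coeff₁-vanishes b₁ a≰)
    ... | _      | no πa≰  = trans (sym (coeff₂≈graphCoeff a)) (coeff₂-vanishes b₂ πa≰)

  cycles-determined-by-Lower : ∀ b b′ → IsCycle b → IsCycle b′ →
    (∀ a → Lower a → graphCoeff (proj₂ (proj₂ b)) a ≈ graphCoeff (proj₂ (proj₂ b′)) a) → b B.≈ b′
  cycles-determined-by-Lower (b₁ , b₂ , b₃) (b₁′ , b₂′ , b₃′) cyc cyc′ agree =
      (λ i → trans (X.coeff₁≈graphCoeff i) (trans (graphCoeff≈ i) (sym (X′.coeff₁≈graphCoeff i))))
    , (λ j → ≡.subst (λ y → C₂.coeff b₂ y ≈ C₂.coeff b₂′ y) (π∘π⁻¹ j) (coeff₂≈ (π⁻¹ j)))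
    , λ (a , b) → graph a b
    where
    module X  = CycleCoefficients b₁ b₂ b₃ cyc
    module X′ = CycleCoefficients b₁′ b₂′ b₃′ cyc′
    graphCoeff≈ : ∀ a → graphCoeff b₃ a ≈ graphCoeff b₃′ a
    graphCoeff≈ a with lower? a
    ... | yes lower = agree a lower
    ... | no ¬lower = trans (X.graphCoeff-vanishes a ¬lower) (sym (X′.graphCoeff-vanishes a ¬lower))
    coeff₂≈ : ∀ a → C₂.coeff b₂ (π a) ≈ C₂.coeff b₂′ (π a)
    coeff₂≈ a = trans (X.coeff₂≈graphCoeff a) (trans (graphCoeff≈ a) (sym (X′.coeff₂≈graphCoeff a)))
    graph : ∀ a b → C₃.coeff b₃ (a , b) ≈ C₃.coeff b₃′ (a , b)
    graph a b with b ℤ.≟ π a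
    ... | yes ≡.refl = graphCoeff≈ a
    ... | no b≢πa = trans (coeff₃-off-graph b₃ a b b≢πa) (sym (coeff₃-off-graph b₃′ a b b≢πa))

  module H⁰-Basis {S g} (E : Enumerates S g Lower) where
    open Enumerates E

    fromCoords : (ℤ → Carrier) → Space.Carrier B
    fromCoords c = C₁.tabulate S g (proj₁ ∘ sound) c
                 , C₂.tabulate S (π ∘ g) (proj₂ ∘ sound) c
                 , C₃.tabulate S (λ s → g s , π (g s)) (λ _ → ≡.refl) c

    fromCoords-cycle : ∀ c → IsCycle (fromCoords c)
    fromCoords-cycle c =
        (λ i → x≈y⇒x∙y⁻¹≈ε (trans (C₁.coeff-tabulate S g _ c i)
          (trans (∑-cong S λ s → when-⇔ (g s ℤ.≟ i) (_ ≟² (i , π i))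
                   (mk⇔ (λ { ≡.refl → ≡.refl }) ,-injectiveˡ) (c s))
                 (sym (C₃.coeff-tabulate S _ _ c _)))))
      , (λ j → x≈y⇒x∙y⁻¹≈ε (trans (C₂.coeff-tabulate S (π ∘ g) _ c j)
          (trans (∑-cong S λ s → when-⇔ (π (g s) ℤ.≟ j) (_ ≟² (π⁻¹ j , j))
                   (mk⇔ (λ { ≡.refl → ≡.cong (_, _) (≡.sym (π⁻¹∘π (g s))) }) ,-injectiveʳ) (c s))
                 (sym (C₃.coeff-tabulate S _ _ c _)))))

    basis : Basis H⁰ S
    basis = record
      { coord            = λ s b _ → graphCoeff (proj₂ (proj₂ b)) (g s)
      ; coord-cong       = λ _ _ _ _ _ (_ , _ , b₃≈b₃′) → b₃≈b₃′ _
      ; coord-+          = λ _ x y _ _ _ → C₃.coeff-++ (proj₂ (proj₂ x)) (proj₂ (proj₂ y)) _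
      ; coord-·          = λ _ c x _ _ → C₃.coeff-· c (proj₂ (proj₂ x)) _
      ; +-closed         = λ x y (_ , ∂x≈0) (_ , ∂y≈0) → _ , IsCycle⇒∂≈0 (x B.+ y)
          (IsCycle-+ x y (∂≈0⇒IsCycle x ∂x≈0) (∂≈0⇒IsCycle y ∂y≈0))
      ; ·-closed         = λ c x (_ , ∂x≈0) → _ , IsCycle⇒∂≈0 (c B.· x)
          (IsCycle-· c x (∂≈0⇒IsCycle x ∂x≈0))
      ; coord-injective  = λ x y (_ , ∂x≈0) (_ , ∂y≈0) agree →
          cycles-determined-by-Lower x y (∂≈0⇒IsCycle x ∂x≈0) (∂≈0⇒IsCycle y ∂y≈0) λ a lower →
            let s , s∈S , gs≡a = complete lower
            in ≡.subst (λ a → graphCoeff (proj₂ (proj₂ x)) a ≈ graphCoeff (proj₂ (proj₂ y)) a)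
                       gs≡a (agree s∈S)
      ; fromCoords       = fromCoords
      ; fromCoords-in    = λ c → _ , IsCycle⇒∂≈0 (fromCoords c) (fromCoords-cycle c)
      ; coord-fromCoords = λ c {t} t∈S → trans (C₃.coeff-tabulate S _ _ c _)
          (trans (∑-cong S λ s → when-⇔ (_ ≟² _) (s ℤ.≟ t)
                   (mk⇔ (injective ∘ ,-injectiveˡ) (λ { ≡.refl → ≡.refl })) (c s))
                 (∑-when-≡ ℤ._≟_ unique t∈S c))
      }

  cokerCoeff : Space.Carrier A → ℤ → Carrier
  cokerCoeff (u₁ , u₂) a = Cᴬ.coeff u₁ a - Cᴬ.coeff u₂ (π a)

  cokerCoeff-cong : ∀ u v → u A.≈ v → ∀ a → cokerCoeff u a ≈ cokerCoeff v a
  cokerCoeff-cong _ _ (u₁≈v₁ , u₂≈v₂) a = -‿cong₂ (u₁≈v₁ a) (u₂≈v₂ (π a))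

  cokerCoeff-+ : ∀ u v a → cokerCoeff (u A.+ v) a ≈ cokerCoeff u a + cokerCoeff v a
  cokerCoeff-+ (u₁ , u₂) (v₁ , v₂) a =
    trans (-‿cong₂ (Cᴬ.coeff-++ u₁ v₁ a) (Cᴬ.coeff-++ u₂ v₂ (π a))) (-‿+-interchange _ _ _ _)

  cokerCoeff-· : ∀ c u a → cokerCoeff (c A.· u) a ≈ c * cokerCoeff u a
  cokerCoeff-· c (u₁ , u₂) a =
    trans (-‿cong₂ (Cᴬ.coeff-· c u₁ a) (Cᴬ.coeff-· c u₂ (π a))) (sym (x[y-z]≈xy-xz _ _ _))

  cokerCoeff-sub : ∀ u v a → cokerCoeff (u A.-ᵥ v) a ≈ cokerCoeff u a - cokerCoeff v a
  cokerCoeff-sub u v a = trans (cokerCoeff-+ u (A.- v) a)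
    (+-congˡ (trans (-‿cong₂ (Cᴬ.coeff-neg (proj₁ v) a) (Cᴬ.coeff-neg (proj₂ v) (π a)))
                    (⁻¹-∙-comm _ _)))

  cokerCoeff-∂ : ∀ b {a} → Upper a → cokerCoeff (∂ b) a ≈ 0#
  cokerCoeff-∂ b@(b₁ , b₂ , b₃) {a} (a≰ , πa≰) = begin
    cokerCoeff (∂ b) a
      ≈⟨ -‿cong₂ (coeff-∂₁ b a) (coeff-∂₂ b (π a)) ⟩
    (C₁.coeff b₁ a - graphCoeff b₃ a) - (C₂.coeff b₂ (π a) - C₃.coeff b₃ (π⁻¹ (π a) , π a))
      ≈⟨ -‿cong₂ (-‿cong₂ (coeff₁-vanishes b₁ a≰) refl)
                 (-‿cong₂ (coeff₂-vanishes b₂ πa≰)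
                          (reflexive (≡.cong (λ x → C₃.coeff b₃ (x , π a)) (π⁻¹∘π a)))) ⟩
    (0# - graphCoeff b₃ a) - (0# - graphCoeff b₃ a)
      ≈⟨ x-x≈0 _ ⟩
    0# ∎
    where open SetoidReasoning setoid

  graphPoint : ℤ → Carrier → C₃.Entries
  graphPoint a c = (((a , π a) , ≡.refl) , c) ∷ []

  graphCoeff-graphPoint : ∀ a c i → graphCoeff (graphPoint a c) i ≈ when (a ℤ.≟ i) c
  graphCoeff-graphPoint a c i =
    trans (sym (coeff-ρ₃₁ (graphPoint a c) i)) (Cᴬ.coeff-single (a , tt) c i)

  coeff₃-graphPoint : ∀ a c j → C₃.coeff (graphPoint a c) (π⁻¹ j , j) ≈ when (π a ℤ.≟ j) c
  coeff₃-graphPoint a c j =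
    trans (sym (coeff-ρ₃₂ (graphPoint a c) j)) (Cᴬ.coeff-single (π a , tt) c j)

  -- a preimage under ∂ of c·e_j ∈ A₁, up to an error supported on Upper
  lift₁ : Cᴬ.Index × Carrier → Space.Carrier B
  lift₁ ((j , _) , c) with j ≤? d₁ | π j ≤? d₂
  ... | yes j≤ | _       = ((j , j≤) , c) ∷ [] , [] , []
  ... | no _   | yes πj≤ = [] , ((π j , πj≤) , - c) ∷ [] , graphPoint j (- c)
  ... | no _   | no _    = [] , [] , []

  -- a preimage under ∂ of c·e_j ∈ A₂, up to an error in A₁ supported on Upper
  lift₂ : Cᴬ.Index × Carrier → Space.Carrier B
  lift₂ ((j , _) , c) with j ≤? d₂ | π⁻¹ j ≤? d₁
  ... | yes j≤ | _      = [] , ((j , j≤) , c) ∷ [] , []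
  ... | no _   | yes a≤ = ((π⁻¹ j , a≤) , - c) ∷ [] , [] , graphPoint (π⁻¹ j) (- c)
  ... | no _   | no _   = [] , [] , graphPoint (π⁻¹ j) (- c)

  ∂₁ᶜ-lift₁-outside : ∀ t {i} → ¬ Upper i → ∂₁ᶜ (lift₁ t) i ≈ when (proj₁ (proj₁ t) ℤ.≟ i) (proj₂ t)
  ∂₁ᶜ-lift₁-outside ((j , _) , c) {i} ¬upper with j ≤? d₁ | π j ≤? d₂
  ... | yes j≤ | _      = trans (x-0≈x _) (C₁.coeff-single (j , j≤) c i)
  ... | no _   | yes _  = trans (+-identityˡ _)
    (trans (-‿cong (graphCoeff-graphPoint j (- c) i)) (-‿when-‿ (j ℤ.≟ i) c))
  ... | no j≰  | no πj≰ = trans 0-0≈0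
    (sym (when-¬ (j ℤ.≟ i) (λ { ≡.refl → ¬upper (j≰ , πj≰) }) c))

  ∂₁ᶜ-lift₁-inside : ∀ t {i} → Upper i → ∂₁ᶜ (lift₁ t) i ≈ 0#
  ∂₁ᶜ-lift₁-inside ((j , _) , c) {i} (i≰ , πi≰) with j ≤? d₁ | π j ≤? d₂
  ... | yes j≤ | _       = trans (x-0≈x _)
    (trans (C₁.coeff-single (j , j≤) c i) (when-¬ (j ℤ.≟ i) (λ { ≡.refl → i≰ j≤ }) c))
  ... | no _   | yes πj≤ = trans (+-congˡ (-‿cong (trans (graphCoeff-graphPoint j (- c) i)
    (when-¬ (j ℤ.≟ i) (λ { ≡.refl → πi≰ πj≤ }) (- c))))) 0-0≈0
  ... | no _   | no _    = 0-0≈0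

  ∂₂ᶜ-lift₁ : ∀ t j′ → ∂₂ᶜ (lift₁ t) j′ ≈ 0#
  ∂₂ᶜ-lift₁ ((j , _) , c) j′ with j ≤? d₁ | π j ≤? d₂
  ... | yes _ | _       = 0-0≈0
  ... | no _  | yes πj≤ = trans
    (-‿cong₂ (C₂.coeff-single (π j , πj≤) (- c) j′) (coeff₃-graphPoint j (- c) j′)) (x-x≈0 _)
  ... | no _  | no _    = 0-0≈0

  0-coeff₃-graphPoint : ∀ j c j′ →
    0# - C₃.coeff (graphPoint (π⁻¹ j) (- c)) (π⁻¹ j′ , j′) ≈ when (j ℤ.≟ j′) c
  0-coeff₃-graphPoint j c j′ = trans (+-identityˡ _)
    (trans (-‿cong (coeff₃-graphPoint (π⁻¹ j) (- c) j′))
    (trans (-‿when-‿ (π (π⁻¹ j) ℤ.≟ j′) c)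
           (when-⇔ (π (π⁻¹ j) ℤ.≟ j′) (j ℤ.≟ j′)
                   (mk⇔ (≡.trans (≡.sym (π∘π⁻¹ j))) (≡.trans (π∘π⁻¹ j))) c)))

  ∂₁ᶜ-lift₂-outside : ∀ t {i} → ¬ Upper i → ∂₁ᶜ (lift₂ t) i ≈ 0#
  ∂₁ᶜ-lift₂-outside ((j , _) , c) {i} ¬upper with j ≤? d₂ | π⁻¹ j ≤? d₁
  ... | yes _ | _      = 0-0≈0
  ... | no _  | yes a≤ = trans (-‿cong₂ (C₁.coeff-single (π⁻¹ j , a≤) (- c) i)
                                       (graphCoeff-graphPoint (π⁻¹ j) (- c) i)) (x-x≈0 _)
  ... | no j≰ | no a≰  = trans (+-congˡ (-‿cong (trans (graphCoeff-graphPoint (π⁻¹ j) (- c) i)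
    (when-¬ (π⁻¹ j ℤ.≟ i) (λ { ≡.refl → ¬upper (a≰ , j≰ ∘ ≡.subst (_≤ d₂) (π∘π⁻¹ j)) }) (- c)))))
    0-0≈0

  ∂₁ᶜ-lift₂-inside : ∀ t {i} → Upper i → ∂₁ᶜ (lift₂ t) i ≈ when (proj₁ (proj₁ t) ℤ.≟ π i) (proj₂ t)
  ∂₁ᶜ-lift₂-inside ((j , _) , c) {i} (i≰ , πi≰) with j ≤? d₂ | π⁻¹ j ≤? d₁
  ... | yes j≤ | _      = trans 0-0≈0 (sym (when-¬ (j ℤ.≟ π i) (λ { ≡.refl → πi≰ j≤ }) c))
  ... | no _   | yes a≤ = trans (-‿cong₂ (C₁.coeff-single (π⁻¹ j , a≤) (- c) i)
                                        (graphCoeff-graphPoint (π⁻¹ j) (- c) i))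
    (trans (x-x≈0 _) (sym (when-¬ (j ℤ.≟ π i) (λ { ≡.refl → i≰ (≡.subst (_≤ d₁) (π⁻¹∘π i) a≤) }) c)))
  ... | no _   | no _   = trans (+-identityˡ _) (trans (-‿cong (graphCoeff-graphPoint (π⁻¹ j) (- c) i))
    (trans (-‿when-‿ (π⁻¹ j ℤ.≟ i) c)
           (when-⇔ (π⁻¹ j ℤ.≟ i) (j ℤ.≟ π i)
                   (mk⇔ (λ { ≡.refl → ≡.sym (π∘π⁻¹ j) }) (λ { ≡.refl → π⁻¹∘π i })) c)))

  ∂₂ᶜ-lift₂ : ∀ t j′ → ∂₂ᶜ (lift₂ t) j′ ≈ when (proj₁ (proj₁ t) ℤ.≟ j′) (proj₂ t)
  ∂₂ᶜ-lift₂ ((j , _) , c) j′ with j ≤? d₂ | π⁻¹ j ≤? d₁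
  ... | yes j≤ | _     = trans (x-0≈x _) (C₂.coeff-single (j , j≤) c j′)
  ... | no _   | yes _ = 0-coeff₃-graphPoint j c j′
  ... | no _   | no _  = 0-coeff₃-graphPoint j c j′

  liftAll : (Cᴬ.Index × Carrier → Space.Carrier B) → Cᴬ.Entries → Space.Carrier B
  liftAll f []      = B.0v
  liftAll f (t ∷ u) = f t B.+ liftAll f u

  ∂₁ᶜ-liftAll : ∀ f u i → ∂₁ᶜ (liftAll f u) i ≈ ∑[ t ← u ] ∂₁ᶜ (f t) i
  ∂₁ᶜ-liftAll f []      i = 0-0≈0
  ∂₁ᶜ-liftAll f (t ∷ u) i = trans (∂₁ᶜ-+ (f t) (liftAll f u) i) (+-congˡ (∂₁ᶜ-liftAll f u i))

  ∂₂ᶜ-liftAll : ∀ f u j → ∂₂ᶜ (liftAll f u) j ≈ ∑[ t ← u ] ∂₂ᶜ (f t) j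
  ∂₂ᶜ-liftAll f []      j = 0-0≈0
  ∂₂ᶜ-liftAll f (t ∷ u) j = trans (∂₂ᶜ-+ (f t) (liftAll f u) j) (+-congˡ (∂₂ᶜ-liftAll f u j))

  preimage : Space.Carrier A → Space.Carrier B
  preimage (u₁ , u₂) = liftAll lift₁ u₁ B.+ liftAll lift₂ u₂

  -- the errors of the two lifts cancel exactly when cokerCoeff u vanishes on Upper
  ∂-preimage : ∀ u → (∀ {a} → Upper a → cokerCoeff u a ≈ 0#) → ∂ (preimage u) A.≈ u
  ∂-preimage u@(u₁ , u₂) cokerCoeff≈0 = first , second
    where
    open SetoidReasoning setoid
    ∂₁ᶜ-preimage : ∀ i → ∂₁ᶜ (preimage u) i ≈ ∑[ t ← u₁ ] ∂₁ᶜ (lift₁ t) i + ∑[ t ← u₂ ] ∂₁ᶜ (lift₂ t) i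
    ∂₁ᶜ-preimage i = trans (∂₁ᶜ-+ (liftAll lift₁ u₁) (liftAll lift₂ u₂) i)
                           (+-cong (∂₁ᶜ-liftAll lift₁ u₁ i) (∂₁ᶜ-liftAll lift₂ u₂ i))
    first : ∀ i → Cᴬ.coeff (proj₁ (∂ (preimage u))) i ≈ Cᴬ.coeff u₁ i
    first i with upper? i
    ... | yes upper = begin
      Cᴬ.coeff (proj₁ (∂ (preimage u))) i ≈⟨ trans (coeff-∂₁ (preimage u) i) (∂₁ᶜ-preimage i) ⟩
      _ + _                                ≈⟨ +-cong (∑-zero u₁ λ {t} _ → ∂₁ᶜ-lift₁-inside t upper)
                                                     (∑-cong u₂ λ t → ∂₁ᶜ-lift₂-inside t upper) ⟩
      0# + _                               ≈⟨ +-identityˡ _ ⟩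
      _                                    ≈⟨ Cᴬ.coeff-∑ u₂ (π i) ⟨
      Cᴬ.coeff u₂ (π i)                    ≈⟨ x∙y⁻¹≈ε⇒x≈y _ _ (cokerCoeff≈0 upper) ⟨
      Cᴬ.coeff u₁ i                        ∎
    ... | no ¬upper = begin
      Cᴬ.coeff (proj₁ (∂ (preimage u))) i ≈⟨ trans (coeff-∂₁ (preimage u) i) (∂₁ᶜ-preimage i) ⟩
      _ + _                                ≈⟨ +-cong (∑-cong u₁ λ t → ∂₁ᶜ-lift₁-outside t ¬upper)
                                                     (∑-zero u₂ λ {t} _ → ∂₁ᶜ-lift₂-outside t ¬upper) ⟩
      _ + 0#                               ≈⟨ +-identityʳ _ ⟩
      _                                    ≈⟨ Cᴬ.coeff-∑ u₁ i ⟨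
      Cᴬ.coeff u₁ i                        ∎
    second : ∀ j → Cᴬ.coeff (proj₂ (∂ (preimage u))) j ≈ Cᴬ.coeff u₂ j
    second j = begin
      Cᴬ.coeff (proj₂ (∂ (preimage u))) j
        ≈⟨ trans (coeff-∂₂ (preimage u) j) (∂₂ᶜ-+ (liftAll lift₁ u₁) (liftAll lift₂ u₂) j) ⟩
      _ + _
        ≈⟨ +-cong (trans (∂₂ᶜ-liftAll lift₁ u₁ j) (∑-zero u₁ λ {t} _ → ∂₂ᶜ-lift₁ t j))
                  (trans (∂₂ᶜ-liftAll lift₂ u₂ j) (∑-cong u₂ λ t → ∂₂ᶜ-lift₂ t j)) ⟩
      0# + _               ≈⟨ +-identityˡ _ ⟩
      _                    ≈⟨ Cᴬ.coeff-∑ u₂ j ⟨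
      Cᴬ.coeff u₂ j        ∎

  module H¹-Basis {S g} (E : Enumerates S g Upper) where
    open Enumerates E

    cokerCoeff-cong-H¹ : ∀ {s} → s ∈ S → ∀ x y → x ⟨ Space._≈_ H¹ ⟩ y →
                         cokerCoeff x (g s) ≈ cokerCoeff y (g s)
    cokerCoeff-cong-H¹ s∈S x y (b , _ , ∂b≈x-y) = x∙y⁻¹≈ε⇒x≈y _ _ (begin
      cokerCoeff x _ - cokerCoeff y _ ≈⟨ cokerCoeff-sub x y _ ⟨
      cokerCoeff (x A.-ᵥ y) _         ≈⟨ cokerCoeff-cong (∂ b) (x A.-ᵥ y) ∂b≈x-y _ ⟨
      cokerCoeff (∂ b) _              ≈⟨ cokerCoeff-∂ b (sound s∈S) ⟩
      0#                              ∎)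
      where open SetoidReasoning setoid

    basis : Basis H¹ S
    basis = record
      { coord            = λ s u _ → cokerCoeff u (g s)
      ; coord-cong       = λ s∈S x y _ _ → cokerCoeff-cong-H¹ s∈S x y
      ; coord-+          = λ s x y _ _ _ → cokerCoeff-+ x y (g s)
      ; coord-·          = λ s c x _ _ → cokerCoeff-· c x (g s)
      ; +-closed         = λ _ _ _ _ → tt , tt
      ; ·-closed         = λ _ _ _ → tt , tt
      ; coord-injective  = λ x y _ _ agree → preimage (x A.-ᵥ y) , _ , ∂-preimage (x A.-ᵥ y) λ upper →
          let s , s∈S , gs≡a = complete upper
          in trans (cokerCoeff-sub x y _)
               (x≈y⇒x∙y⁻¹≈ε (≡.subst (λ a → cokerCoeff x a ≈ cokerCoeff y a) gs≡a (agree s∈S)))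
      ; fromCoords       = λ c → Cᴬ.tabulate S g (λ _ → tt) c , []
      ; fromCoords-in    = λ _ → tt , tt
      ; coord-fromCoords = λ c {t} t∈S → trans (x-0≈x _)
          (trans (Cᴬ.coeff-tabulate S g (λ _ → tt) c (g t))
          (trans (∑-cong S λ s → when-⇔ (g s ℤ.≟ g t) (s ℤ.≟ t) (mk⇔ injective (≡.cong g)) (c s))
                 (∑-when-≡ ℤ._≟_ unique t∈S c)))
      }

module Duality (k : Field) (W : ℤ → ℤ → ℤ) (pm : IsPerfectMatching W) (d₁ d₂ K₁ K₂ : ℤ) where
  open import Data.Integer using (_+_; _-_)
  open IntegerFacts
  open Enumeration
  open LinearAlgebra k
  open Bases k
  open IsPerfectMatching pm using (π; on-graph; lo; hi; below; above)

  L₁ L₂ : ℤ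
  L₁ = K₁ + + 1
  L₂ = K₂ + + 1

  module V  = MatchingDiagram k W pm d₁ d₂
  module V* = MatchingDiagram k (dualW (L₁ , L₂) W) (dualPM (L₁ , L₂) pm) (K₁ - d₁) (K₂ - d₂)

  π*-reflect : ∀ a → V*.π (L₁ - a) ≡ L₂ - π a
  π*-reflect a = ≡.cong (λ x → L₂ - π x) (reflect-involutive L₁ a)

  lower⇔upper* : ∀ a → V.Lower a ⇔ V*.Upper (L₁ - a)
  lower⇔upper* a = mk⇔
    (λ (a≤ , πa≤) → to (≤⇔reflect-≰ K₁ d₁ a) a≤
                  , to (≤⇔reflect-≰ K₂ d₂ (π a)) πa≤ ∘ ≡.subst (_≤ K₂ - d₂) (π*-reflect a))
    (λ (a≰ , πa≰) → from (≤⇔reflect-≰ K₁ d₁ a) a≰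
                  , from (≤⇔reflect-≰ K₂ d₂ (π a)) (πa≰ ∘ ≡.subst (_≤ K₂ - d₂) (≡.sym (π*-reflect a))))
    where open Equivalence

  upper⇔lower* : ∀ a → V.Upper a ⇔ V*.Lower (L₁ - a)
  upper⇔lower* a = mk⇔
    (λ (a≰ , πa≰) → to (≰⇔reflect-≤ K₁ d₁ a) a≰
                  , ≡.subst (_≤ K₂ - d₂) (≡.sym (π*-reflect a)) (to (≰⇔reflect-≤ K₂ d₂ (π a)) πa≰))
    (λ (a≤ , πa≤) → from (≰⇔reflect-≤ K₁ d₁ a) a≤
                  , from (≰⇔reflect-≤ K₂ d₂ (π a)) (≡.subst (_≤ K₂ - d₂) (π*-reflect a) πa≤))
    where open Equivalence

  1≢0 : + 1 ≢ + 0
  1≢0 ()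

  -- W(a, π a) = 1 forces the graph of π into the strip lo ≤ a + b ≤ hi
  lo≤a+πa : ∀ a → lo ≤ a + π a
  lo≤a+πa a = ℤP.≮⇒≥ λ lt → 1≢0 (≡.trans (≡.sym (on-graph a)) (below a (π a) lt))

  a+πa≤hi : ∀ a → a + π a ≤ hi
  a+πa≤hi a = ℤP.≮⇒≥ λ lt → 1≢0 (≡.trans (≡.sym (on-graph a)) (above a (π a) lt))

  lower-bounded : ∀ {a} → V.Lower a → lo - d₂ ≤ a × a ≤ d₁
  lower-bounded {a} (a≤ , πa≤) =
      ℤP.≤-trans (ℤP.+-monoˡ-≤ (ℤ.- d₂) (lo≤a+πa a))
                 (≤-translate (a - d₂) πa≤ (e₁ a (π a) d₂) (e₂ a d₂))
    , a≤
    where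
    e₁ : ∀ a b d → (a - d) + b ≡ (a + b) - d
    e₁ = solve-∀
    e₂ : ∀ a d → (a - d) + d ≡ a
    e₂ = solve-∀

  upper-bounded : ∀ {a} → V.Upper a → d₁ + + 1 ≤ a × a ≤ hi - d₂
  upper-bounded {a} (a≰ , πa≰) =
      ≡.subst (_≤ a) (ℤP.+-comm (+ 1) d₁) (ℤP.i<j⇒suc[i]≤j (ℤP.≰⇒> a≰))
    , ≤-translate (ℤ.- d₂) (ℤP.≤-trans (ℤP.+-monoʳ-≤ a (ℤP.<⇒≤ (ℤP.≰⇒> πa≰))) (a+πa≤hi a))
                  (e₁ a d₂) (e₂ hi d₂)
    where
    e₁ : ∀ a d → ℤ.- d + (a + d) ≡ a
    e₁ = solve-∀
    e₂ : ∀ h d → ℤ.- d + h ≡ h - d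
    e₂ = solve-∀

  lower-enumeration : Σ (List ℤ) λ S → Enumerates S id V.Lower
  lower-enumeration = enumerate V.lower? (lo - d₂) d₁ lower-bounded

  upper-enumeration : Σ (List ℤ) λ S → Enumerates S id V.Upper
  upper-enumeration = enumerate V.upper? (d₁ + + 1) (hi - d₂) upper-bounded

  record DualBases (i : Fin 2) : Set₁ where
    field
      index   : List ℤ
      unique  : Unique index
      basis   : Basis (H i V.D) index
      basis*  : Basis (H (compl i) V*.D) index

  dualBases : ∀ i → DualBases i
  dualBases zero = record
    { index  = proj₁ lower-enumeration
    ; unique = Enumerates.unique (proj₂ lower-enumeration)
    ; basis  = V.H⁰-Basis.basis (proj₂ lower-enumeration)
    ; basis* = V*.H¹-Basis.basis
                 (reindex (L₁ -_) (reflect-involutive L₁) lower⇔upper* (proj₂ lower-enumeration))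
    }
  dualBases (suc zero) = record
    { index  = proj₁ upper-enumeration
    ; unique = Enumerates.unique (proj₂ upper-enumeration)
    ; basis  = V.H¹-Basis.basis (proj₂ upper-enumeration)
    ; basis* = V*.H⁰-Basis.basis
                 (reindex (L₁ -_) (reflect-involutive L₁) upper⇔lower* (proj₂ upper-enumeration))
    }

module DirectSums (k : Field) (d₁ d₂ K₁ K₂ : ℤ) where
  open import Data.Integer using (_+_; _-_)
  open LinearAlgebra k
  open Bases k
  open TaggedUnion

  ⨁-dual≅ : ∀ {n} (Ws : Fin n → ℤ → ℤ → ℤ) (pms : ∀ r → IsPerfectMatching (Ws r)) (i : Fin 2) →
    LinearIso (Dual (⨁ λ r → H i (M (Ws r) (pms r) (d₁ , d₂))))
              (⨁ λ r → H (compl i) (M (dualW (K₁ + + 1 , K₂ + + 1) (Ws r))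
                                      (dualPM (K₁ + + 1 , K₂ + + 1) (pms r)) (K₁ - d₁ , K₂ - d₂)))
  ⨁-dual≅ Ws pms i = DualBasis.dual≅ (≡-dec Fin._≟_ ℤ._≟_)
    (tagged-unique B.index B.unique) (⨁-basis B.index B.basis) (⨁-basis B.index B.basis*)
    where module B r = Duality.DualBases (Duality.dualBases k (Ws r) (pms r) d₁ d₂ K₁ K₂ i)

-- ℤ's _+_ and _-_ are opened only now: above, these symbols are the field operations.
open import Data.Integer using (_-_; _+_)

theorem9p5 : (k : Field) (f W : ℤ → ℤ → ℤ) →
    IsRiemannFunction f → IsWeightOf f W →
    (d₁ d₂ K₁ K₂ : ℤ) →
    (s : ℕ) (Ws : Fin (suc s) → ℤ → ℤ → ℤ) (Wt : Fin s → ℤ → ℤ → ℤ) →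
    (pms : ∀ r → IsPerfectMatching (Ws r)) →
    (pmt : ∀ r → IsPerfectMatching (Wt r)) →
    (∀ a b → W a b ≡ sumFin (λ r → Ws r a b) - sumFin (λ r → Wt r a b)) →
    (i : Fin 2) →
    LinearAlgebra.VirtualIso k
      (LinearAlgebra.DualV k (LinearAlgebra.HVirt k i Ws pms Wt pmt (d₁ , d₂)))
      (LinearAlgebra.HVirt k (LinearAlgebra.compl k i)
        (λ r → dualW (K₁ + + 1 , K₂ + + 1) (Ws r))
        (λ r → dualPM (K₁ + + 1 , K₂ + + 1) (pms r))
        (λ r → dualW (K₁ + + 1 , K₂ + + 1) (Wt r))
        (λ r → dualPM (K₁ + + 1 , K₂ + + 1) (pmt r))
        (K₁ - d₁ , K₂ - d₂))
theorem9p5 k _ _ _ _ d₁ d₂ K₁ K₂ _ Ws Wt pms pmt _ i = ⨁-dual≅ Ws pms i , ⨁-dual≅ Wt pmt i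
  where open DirectSums k d₁ d₂ K₁ K₂
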